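{- Let $m,R,\delta$ be positive integers and let $\phi: U(m,R,\delta)\to U(m,R,\delta-1)$ be the map $\langle \alpha, A_1, \ldots, A_{\delta} \rangle\mapsto\langle \alpha, A_1, \ldots, A_{\delta-1} \rangle$. For every $\mathcal A \in V(U(m,R,\delta))$, we have $| \phi(N(\mathcal{A})) | \leq 2^{2 \cdot sz(\mathcal{A})} \leq 2^{2 R}$.
   Context: A chain of length $f$ and size $s$ in $[m]$ is a nested sequence $A_0\subseteq\cdots\subseteq A_f\subseteq[m]$ with $|A_0|=1$, $|A_f|=s$, written $\langle\alpha,A_1,\dots,A_f\rangle$ where $A_0=\{\alpha\}$; $sz(\mathcal A)=|A_f|$ denotes its size. The graph $U(m,R,\delta)$ has as vertices all chains in $[m]$ of length $\delta$ and size at most $R$, and $\langle\alpha,A_1,\dots,A_\delta\rangle$, $\langle\beta,B_1,\dots,B_\delta\rangle$ are adjacent iff $\alpha\neq\beta$, $\alpha\in B_1$, $\beta\in A_1$, and $A_i\subseteq B_{i+1}$, $B_i\subseteq A_{i+1}$ for all $1\le i\le\delta-1$. $N(\mathcal A)$ is the set of neighbours of $\mathcal A$ in $U(m,R,\delta)$ and $\phi(X)=\{\phi(x):x\in X\}$. -}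

module Defs where

open import Data.Nat using (ℕ; zero; suc; _≤_)
open import Data.Fin using (Fin; zero; suc; inject₁)
open import Data.Fin.Subset using (Subset; ⁅_⁆; _⊆_; _∈_; ∣_∣)
open import Data.Vec using (Vec; []; _∷_; lookup)
open import Data.Product using (Σ; _×_; _,_)
open import Data.Unit using (⊤)
open import Relation.Binary.PropositionalEquality using (_≡_; _≢_)

-- A chain of length f in [m]: ⟨α, A₁, …, A_f⟩, with A₀ = {α}.
-- Represented as α together with the vector (A₁, …, A_f).
Chain : ℕ → ℕ → Set
Chain m f = Fin m × Vec (Subset m) f

Nested : ∀ {m f} → Subset m → Vec (Subset m) f → Set
Nested prev []       = ⊤
Nested prev (A ∷ As) = (prev ⊆ A) × Nested A As

top : ∀ {m f} → Subset m → Vec (Subset m) f → Subset m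
top prev []       = prev
top prev (A ∷ As) = top A As

sz : ∀ {m f} → Chain m f → ℕ
sz (α , As) = ∣ top ⁅ α ⁆ As ∣

IsVertex : ∀ m (R δ : ℕ) → Chain m δ → Set
IsVertex m R δ (α , As) = Nested ⁅ α ⁆ As × sz {m} {δ} (α , As) ≤ R

-- adjacency in U(m,R,δ) for δ = suc d ≥ 1; vector index i stands for A_{i+1}
Adj : ∀ {m d} → Chain m (suc d) → Chain m (suc d) → Set
Adj {m} {d} (α , As) (β , Bs) =
  (α ≢ β) × (α ∈ lookup Bs zero) × (β ∈ lookup As zero) ×
  ((i : Fin d) → lookup As (inject₁ i) ⊆ lookup Bs (suc i)) ×
  ((i : Fin d) → lookup Bs (inject₁ i) ⊆ lookup As (suc i))

dropLast : ∀ {A : Set} {n} → Vec A (suc n) → Vec A n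
dropLast (x ∷ [])       = []
dropLast (x ∷ (y ∷ ys)) = x ∷ dropLast (y ∷ ys)

φ : ∀ {m d} → Chain m (suc d) → Chain m d
φ (α , As) = α , dropLast As

InφN : ∀ m R d → Chain m (suc d) → Chain m d → Set
InφN m R d 𝒜 𝒞 =
  Σ (Chain m (suc d)) λ ℬ → IsVertex m R (suc d) ℬ × Adj 𝒜 ℬ × φ ℬ ≡ 𝒞

-- Read a chain column by column: the column of x ∈ [m] is the monotone 0/1 vector
-- recording which of the levels A₀ = {α} ⊆ A₁ ⊆ … ⊆ A_δ contain x, and a chain is
-- determined by its columns.  Adjacency says Aᵢ ⊆ Bᵢ₊₁ and Bᵢ ⊆ Aᵢ₊₁, so x enters ℬ
-- one level before, at the same level as, or one level after it enters 𝒜.  After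
-- dropping the last level (φ) the column of x in φ(ℬ) is therefore one of three
-- shifts of its column in 𝒜, and it is all zero when x ∉ A_δ.  Hence
-- |φ(N(𝒜))| ≤ 3^sz(𝒜) ≤ 4^sz(𝒜).
module Submission where

open import Defs
open import Data.Nat using (ℕ; suc; _≤_; _<_; _^_; _*_)
open import Data.List using (List; length)
open import Data.List.Relation.Unary.All using (All)
open import Data.List.Relation.Unary.Unique.Propositional using (Unique)
open import Data.Product using (_×_)

open import Data.Nat using (zero; _+_; z≤n; s≤s)
open import Data.Bool.Base using (Bool; true; false; if_then_else_; b≤b) renaming (_≤_ to _≤ᵇ_)
import Data.Bool.Properties as Boolₚ
open import Data.Fin using (Fin; zero; suc; inject₁)
open import Data.Fin.Subset using (Subset; ⁅_⁆; _⊆_; _∈_; _∉_; ∣_∣)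
open import Data.Fin.Subset.Properties using (x∈⁅x⁆; x∈⁅y⁆⇒x≡y; drop-there)
open import Data.List as List using ([]; _∷_; [_]; _++_; cartesianProductWith)
open import Data.List.Membership.Propositional using (_─_) renaming (_∈_ to _∈ₗ_)
open import Data.List.Membership.Propositional.Properties using (∈-map⁻; ∈-cartesianProductWith⁺)
open import Data.List.Properties using (length-++; length-map; length-removeAt′)
open import Data.List.Relation.Binary.Subset.Propositional using () renaming (_⊆_ to _⊆ₗ_)
import Data.List.Relation.Unary.All as All
open import Data.List.Relation.Unary.Any using (here; there; index)
open import Data.List.Relation.Unary.AllPairs using (_∷_)
import Data.List.Relation.Unary.Unique.Propositional.Properties as Unique
open import Data.Nat.Properties
  using ( ≤-refl; ≤-reflexive; ≤-trans; *-mono-≤; *-monoʳ-≤; ^-monoˡ-≤; ^-monoʳ-≤; ^-*-assoc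
        ; *-identityˡ; n≤1+n; module ≤-Reasoning)
open import Data.Product using (_,_)
open import Data.Vec as Vec using (Vec; []; _∷_; lookup; tabulate; replicate; head; tail; last)
open import Data.Vec.Properties
  using (lookup-map; lookup∘tabulate; lookup⇒[]=; []=⇒lookup; ∷-injectiveˡ; ∷-injectiveʳ)
open import Data.Vec.Relation.Binary.Pointwise.Extensional using (ext; Pointwise-≡⇒≡)
open import Function using (_∘_)
open import Relation.Binary.PropositionalEquality
  using (_≡_; _≢_; refl; sym; trans; cong; cong₂; subst; subst₂; module ≡-Reasoning)
open import Relation.Nullary using (contradiction)

module _ {A : Set} where

  ∈-─⁺ : ∀ {x y : A} {xs} (x∈xs : x ∈ₗ xs) → y ∈ₗ xs → y ≢ x → y ∈ₗ xs ─ x∈xs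
  ∈-─⁺ (here refl)   (here refl)   y≢x = contradiction refl y≢x
  ∈-─⁺ (here refl)   (there y∈xs)  _   = y∈xs
  ∈-─⁺ (there _)     (here refl)   _   = here refl
  ∈-─⁺ (there x∈xs)  (there y∈xs)  y≢x = there (∈-─⁺ x∈xs y∈xs y≢x)

  unique⊆⇒length≤ : ∀ {xs ys : List A} → Unique xs → xs ⊆ₗ ys → length xs ≤ length ys
  unique⊆⇒length≤ {[]} _ _ = z≤n
  unique⊆⇒length≤ {x ∷ xs} {ys} (x∉xs ∷ unique) xs⊆ys = begin
    suc (length xs)          ≤⟨ s≤s (unique⊆⇒length≤ unique xs⊆ys─x) ⟩
    suc (length (ys ─ x∈ys)) ≡⟨ length-removeAt′ ys (index x∈ys) ⟨
    length ys                ∎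
    where
    open ≤-Reasoning
    x∈ys = xs⊆ys (here refl)
    xs⊆ys─x : xs ⊆ₗ ys ─ x∈ys
    xs⊆ys─x y∈xs = ∈-─⁺ x∈ys (xs⊆ys (there y∈xs)) (All.lookup x∉xs y∈xs ∘ sym)

choices : ∀ {X : Set} {n} → (Fin n → List X) → List (Vec X n)
choices {n = zero}  F = [ [] ]
choices {n = suc n} F = cartesianProductWith _∷_ (F zero) (choices (F ∘ suc))

∈-choices : ∀ {X : Set} {n} (F : Fin n → List X) (h : Fin n → X) →
  (∀ i → h i ∈ₗ F i) → tabulate h ∈ₗ choices F
∈-choices {n = zero}  F h _   = here refl
∈-choices {n = suc n} F h h∈F =
  ∈-cartesianProductWith⁺ _∷_ (h∈F zero) (∈-choices (F ∘ suc) (h ∘ suc) (h∈F ∘ suc))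

length-cartesianProductWith : ∀ {X Y Z : Set} (f : X → Y → Z) xs ys →
  length (cartesianProductWith f xs ys) ≡ length xs * length ys
length-cartesianProductWith f []       ys = refl
length-cartesianProductWith f (x ∷ xs) ys = begin
  length (List.map (f x) ys ++ cartesianProductWith f xs ys)
    ≡⟨ length-++ (List.map (f x) ys) ⟩
  length (List.map (f x) ys) + length (cartesianProductWith f xs ys)
    ≡⟨ cong₂ _+_ (length-map (f x) ys) (length-cartesianProductWith f xs ys) ⟩
  length ys + length xs * length ys
    ∎
  where open ≡-Reasoning

length-choices≤ : ∀ {X : Set} {n} k (S : Subset n) (F : Fin n → List X) →
  (∀ i → length (F i) ≤ k) → (∀ i → i ∉ S → length (F i) ≤ 1) →
  length (choices F) ≤ k ^ ∣ S ∣
length-choices≤ k []          F _   _   = ≤-refl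
length-choices≤ k (true ∷ S) F ≤k ≤1 = begin
  length (choices F)                           ≡⟨ length-cartesianProductWith _∷_ (F zero) (choices (F ∘ suc)) ⟩
  length (F zero) * length (choices (F ∘ suc)) ≤⟨ *-mono-≤ (≤k zero) ih ⟩
  k * k ^ ∣ S ∣                                ∎
  where
  open ≤-Reasoning
  ih = length-choices≤ k S (F ∘ suc) (≤k ∘ suc) (λ i i∉S → ≤1 (suc i) (i∉S ∘ drop-there))
length-choices≤ k (false ∷ S) F ≤k ≤1 = begin
  length (choices F)                           ≡⟨ length-cartesianProductWith _∷_ (F zero) (choices (F ∘ suc)) ⟩
  length (F zero) * length (choices (F ∘ suc)) ≤⟨ *-mono-≤ (≤1 zero λ ()) ih ⟩
  1 * k ^ ∣ S ∣                                ≡⟨ *-identityˡ (k ^ ∣ S ∣) ⟩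
  k ^ ∣ S ∣                                    ∎
  where
  open ≤-Reasoning
  ih = length-choices≤ k S (F ∘ suc) (≤k ∘ suc) (λ i i∉S → ≤1 (suc i) (i∉S ∘ drop-there))

-- uᵢ R vᵢ₊₁ for all i.  With u = v this is monotonicity, and adjacency of two
-- chains makes their levels cross-linked in both directions.
CrossLinked : ∀ {A : Set} {n} → (A → A → Set) → Vec A (suc n) → Vec A (suc n) → Set
CrossLinked R u v = ∀ i → R (lookup u (inject₁ i)) (lookup v (suc i))

Monotone : ∀ {A : Set} {n} → (A → A → Set) → Vec A (suc n) → Set
Monotone R v = CrossLinked R v v

dropLast-∷ : ∀ {A : Set} {n} (x : A) (v : Vec A (suc n)) → dropLast (x ∷ v) ≡ x ∷ dropLast v
dropLast-∷ x (_ ∷ _) = refl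

dropLast-replicate : ∀ {A : Set} n (x : A) → dropLast (replicate (suc n) x) ≡ replicate n x
dropLast-replicate zero    x = refl
dropLast-replicate (suc n) x = cong (x ∷_) (dropLast-replicate n x)

map-dropLast : ∀ {A B : Set} {n} (f : A → B) (v : Vec A (suc n)) →
  Vec.map f (dropLast v) ≡ dropLast (Vec.map f v)
map-dropLast f (x ∷ [])    = refl
map-dropLast f (x ∷ y ∷ v) = cong (f x ∷_) (map-dropLast f (y ∷ v))

true≤⇒≡true : ∀ {b} → true ≤ᵇ b → b ≡ true
true≤⇒≡true b≤b = refl

≤false⇒≡false : ∀ {b} → b ≤ᵇ false → b ≡ false
≤false⇒≡false b≤b = refl

head-true⇒replicate : ∀ {n} (v : Vec Bool (suc n)) → Monotone _≤ᵇ_ v → head v ≡ true →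
  v ≡ replicate (suc n) true
head-true⇒replicate (x ∷ [])    _    refl = refl
head-true⇒replicate (x ∷ y ∷ v) mono refl =
  cong (true ∷_) (head-true⇒replicate (y ∷ v) (mono ∘ suc) (true≤⇒≡true (mono zero)))

-- If the monotone column a jumps from false to true at position s, a monotone b
-- cross-linked with a both ways jumps at s - 1, s or s + 1, so dropLast b is
-- tail a, dropLast a or shiftʳ a.
shiftʳ : ∀ {n} → Vec Bool (suc (suc n)) → Vec Bool (suc n)
shiftʳ a = false ∷ dropLast (dropLast a)

shifts : ∀ {n} → Vec Bool (suc (suc n)) → List (Vec Bool (suc n))
shifts a = tail a ∷ dropLast a ∷ shiftʳ a ∷ []

columnChoices : ∀ {n} → Vec Bool (suc (suc n)) → List (Vec Bool (suc n))
columnChoices a = if last a then shifts a else [ replicate _ false ]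

length-columnChoices≤3 : ∀ {n} (a : Vec Bool (suc (suc n))) → length (columnChoices a) ≤ 3
length-columnChoices≤3 a with last a
... | true  = ≤-refl
... | false = s≤s z≤n

length-columnChoices≤1 : ∀ {n} (a : Vec Bool (suc (suc n))) → last a ≡ false →
  length (columnChoices a) ≤ 1
length-columnChoices≤1 a last≡false rewrite last≡false = ≤-refl

false∷-∈shifts : ∀ {n} (a : Vec Bool (suc (suc n))) {u} → Monotone _≤ᵇ_ a →
  u ∈ₗ shifts a → false ∷ u ∈ₗ shifts (false ∷ a)
false∷-∈shifts (false ∷ as) _ (here u≡as) = here (cong (false ∷_) u≡as)
false∷-∈shifts (true ∷ as) {u} mono (here u≡as) = there (here (cong (false ∷_) (begin
  u                           ≡⟨ u≡as ⟩
  as                          ≡⟨ cong tail all-true ⟩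
  replicate _ true            ≡⟨ dropLast-replicate _ true ⟨
  dropLast (replicate _ true) ≡⟨ cong dropLast all-true ⟨
  dropLast (true ∷ as)        ∎)))
  where
  open ≡-Reasoning
  all-true = head-true⇒replicate (true ∷ as) mono refl
false∷-∈shifts (_ ∷ _) _ (there (here u≡dropLast)) = there (here (cong (false ∷_) u≡dropLast))
false∷-∈shifts a@(_ ∷ _) _ (there (there (here u≡shiftʳ))) =
  there (there (here (cong (false ∷_) (trans u≡shiftʳ (sym (dropLast-∷ false (dropLast a)))))))
false∷-∈shifts _ _ (there (there (there ())))

interleaved⇒dropLast∈shifts : ∀ {n} (a b : Vec Bool (suc (suc n))) →
  Monotone _≤ᵇ_ a → Monotone _≤ᵇ_ b → CrossLinked _≤ᵇ_ a b → CrossLinked _≤ᵇ_ b a →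
  dropLast b ∈ₗ shifts a
interleaved⇒dropLast∈shifts (_ ∷ _ ∷ []) (false ∷ _ ∷ []) _ _ _ _ = there (there (here refl))
interleaved⇒dropLast∈shifts (_ ∷ _ ∷ []) (true ∷ _ ∷ []) _ _ _ b≤a =
  here (cong (_∷ []) (sym (true≤⇒≡true (b≤a zero))))
interleaved⇒dropLast∈shifts (_ ∷ a₁ ∷ a₂ ∷ as) (true ∷ bs) ma mb _ b≤a = here (begin
  dropLast (true ∷ bs)        ≡⟨ cong dropLast (head-true⇒replicate (true ∷ bs) mb refl) ⟩
  dropLast (replicate _ true) ≡⟨ dropLast-replicate _ true ⟩
  replicate _ true            ≡⟨ head-true⇒replicate (a₁ ∷ a₂ ∷ as) (ma ∘ suc) (true≤⇒≡true (b≤a zero)) ⟨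
  a₁ ∷ a₂ ∷ as                ∎)
  where open ≡-Reasoning
interleaved⇒dropLast∈shifts a@(true ∷ _ ∷ _ ∷ _) (false ∷ b₁ ∷ bs) ma mb a≤b _ =
  there (there (here (cong (false ∷_) (begin
    dropLast (b₁ ∷ bs)                     ≡⟨ cong dropLast b₁∷bs≡trues ⟩
    dropLast (replicate _ true)            ≡⟨ cong dropLast (dropLast-replicate _ true) ⟨
    dropLast (dropLast (replicate _ true)) ≡⟨ cong (dropLast ∘ dropLast) (head-true⇒replicate a ma refl) ⟨
    dropLast (dropLast a)                  ∎))))
  where
  open ≡-Reasoning
  b₁∷bs≡trues = head-true⇒replicate (b₁ ∷ bs) (mb ∘ suc) (true≤⇒≡true (a≤b zero))
interleaved⇒dropLast∈shifts (false ∷ a@(_ ∷ _ ∷ _)) (false ∷ b@(_ ∷ _)) ma mb a≤b b≤a =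
  false∷-∈shifts a (ma ∘ suc) (interleaved⇒dropLast∈shifts a b (ma ∘ suc) (mb ∘ suc) (a≤b ∘ suc) (b≤a ∘ suc))

last-false⇒dropLast≡replicate : ∀ {n} (a b : Vec Bool (suc n)) →
  Monotone _≤ᵇ_ b → CrossLinked _≤ᵇ_ b a → last a ≡ false → dropLast b ≡ replicate n false
last-false⇒dropLast≡replicate (_ ∷ [])     (_ ∷ [])     _ _   _    = refl
last-false⇒dropLast≡replicate (_ ∷ _ ∷ []) (_ ∷ _ ∷ []) _ b≤a refl = cong (_∷ []) (≤false⇒≡false (b≤a zero))
last-false⇒dropLast≡replicate (_ ∷ a₁ ∷ a₂ ∷ as) (b₀ ∷ b₁ ∷ b₂ ∷ bs) mb b≤a last≡false =
  let ih = last-false⇒dropLast≡replicate (a₁ ∷ a₂ ∷ as) (b₁ ∷ b₂ ∷ bs) (mb ∘ suc) (b≤a ∘ suc) last≡false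
  in cong₂ _∷_ (≤false⇒≡false (subst (b₀ ≤ᵇ_) (cong head ih) (mb zero))) ih

dropLast∈columnChoices : ∀ {n} (a b : Vec Bool (suc (suc n))) →
  Monotone _≤ᵇ_ a → Monotone _≤ᵇ_ b → CrossLinked _≤ᵇ_ a b → CrossLinked _≤ᵇ_ b a →
  dropLast b ∈ₗ columnChoices a
dropLast∈columnChoices a b ma mb a≤b b≤a with last a in last≡
... | true  = interleaved⇒dropLast∈shifts a b ma mb a≤b b≤a
... | false = here (last-false⇒dropLast≡replicate a b mb b≤a last≡)

∉⇒lookup≡false : ∀ {m} {p : Subset m} {x} → x ∉ p → lookup p x ≡ false
∉⇒lookup≡false {p = p} {x} x∉p with lookup p x in p[x]≡
... | true  = contradiction (lookup⇒[]= x p p[x]≡) x∉p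
... | false = refl

⊆⇒lookup≤ : ∀ {m} (x : Fin m) {p q : Subset m} → p ⊆ q → lookup p x ≤ᵇ lookup q x
⊆⇒lookup≤ x {p} {q} p⊆q with lookup p x in p[x]≡
... | false = Boolₚ.≤-minimum (lookup q x)
... | true  = Boolₚ.≤-reflexive (sym ([]=⇒lookup (p⊆q (lookup⇒[]= x p p[x]≡))))

∈⇒⁅⁆⊆ : ∀ {m} {x : Fin m} {p : Subset m} → x ∈ p → ⁅ x ⁆ ⊆ p
∈⇒⁅⁆⊆ {x = x} {p} x∈p y∈⁅x⁆ = subst (_∈ p) (sym (x∈⁅y⁆⇒x≡y x y∈⁅x⁆)) x∈p

⁅⁆-injective : ∀ {m} {x y : Fin m} → ⁅ x ⁆ ≡ ⁅ y ⁆ → x ≡ y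
⁅⁆-injective {x = x} {y} ⁅x⁆≡⁅y⁆ = x∈⁅y⁆⇒x≡y y (subst (x ∈_) ⁅x⁆≡⁅y⁆ (x∈⁅x⁆ x))

column : ∀ {m k} → Vec (Subset m) k → Fin m → Vec Bool k
column Ss x = Vec.map (λ S → lookup S x) Ss

column-injective : ∀ {m k} {Ss Ts : Vec (Subset m) k} →
  (∀ x → column Ss x ≡ column Ts x) → Ss ≡ Ts
column-injective {Ss = Ss} {Ts} columns≡ = Pointwise-≡⇒≡ (ext λ i → Pointwise-≡⇒≡ (ext λ x → begin
  lookup (lookup Ss i) x ≡⟨ lookup-map i _ Ss ⟨
  lookup (column Ss x) i ≡⟨ cong (λ c → lookup c i) (columns≡ x) ⟩
  lookup (column Ts x) i ≡⟨ lookup-map i _ Ts ⟩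
  lookup (lookup Ts i) x ∎))
  where open ≡-Reasoning

last-column : ∀ {m k} (p : Subset m) (As : Vec (Subset m) k) x →
  last (column (p ∷ As) x) ≡ lookup (top p As) x
last-column p []       x = refl
last-column p (A ∷ As) x = last-column A As x

column-crossLinked : ∀ {m k} x (Ss Ts : Vec (Subset m) (suc k)) →
  CrossLinked _⊆_ Ss Ts → CrossLinked _≤ᵇ_ (column Ss x) (column Ts x)
column-crossLinked x Ss Ts Ss⊆Ts i =
  subst₂ _≤ᵇ_ (sym (lookup-map (inject₁ i) _ Ss)) (sym (lookup-map (suc i) _ Ts)) (⊆⇒lookup≤ x (Ss⊆Ts i))

nested⇒monotone : ∀ {m k} (p : Subset m) (As : Vec (Subset m) k) →
  Nested p As → Monotone _⊆_ (p ∷ As)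
nested⇒monotone p (A ∷ As) (p⊆A , _)      zero    = p⊆A
nested⇒monotone p (A ∷ As) (_ , nestedAs) (suc i) = nested⇒monotone A As nestedAs i

levels : ∀ {m k} → Chain m k → Vec (Subset m) (suc k)
levels (α , As) = ⁅ α ⁆ ∷ As

levels-φ : ∀ {m d} (ℬ : Chain m (suc d)) → levels (φ ℬ) ≡ dropLast (levels ℬ)
levels-φ (_ , _ ∷ _) = refl

Adj-sym : ∀ {m d} (𝒜 ℬ : Chain m (suc d)) → Adj 𝒜 ℬ → Adj ℬ 𝒜
Adj-sym _ _ (α≢β , α∈B₁ , β∈A₁ , A⊆B , B⊆A) = α≢β ∘ sym , β∈A₁ , α∈B₁ , B⊆A , A⊆B

Adj⇒crossLinked : ∀ {m d} (𝒜 ℬ : Chain m (suc d)) → Adj 𝒜 ℬ → CrossLinked _⊆_ (levels 𝒜) (levels ℬ)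
Adj⇒crossLinked _ _ (_ , α∈B₁ , _ , _ , _) zero    = ∈⇒⁅⁆⊆ α∈B₁
Adj⇒crossLinked _ _ (_ , _ , _ , A⊆B , _)   (suc i) = A⊆B i

encode : ∀ {m k} → Chain m k → Vec (Vec Bool (suc k)) m
encode 𝒞 = tabulate (column (levels 𝒞))

levels-injective : ∀ {m k} {𝒞 𝒞′ : Chain m k} → levels 𝒞 ≡ levels 𝒞′ → 𝒞 ≡ 𝒞′
levels-injective {𝒞 = _ , _} {_ , _} levels≡ =
  cong₂ _,_ (⁅⁆-injective (∷-injectiveˡ levels≡)) (∷-injectiveʳ levels≡)

encode-injective : ∀ {m k} {𝒞 𝒞′ : Chain m k} → encode 𝒞 ≡ encode 𝒞′ → 𝒞 ≡ 𝒞′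
encode-injective {𝒞 = 𝒞} {𝒞′} encode≡ = levels-injective (column-injective λ x → begin
  column (levels 𝒞) x  ≡⟨ lookup∘tabulate _ x ⟨
  lookup (encode 𝒞) x  ≡⟨ cong (λ M → lookup M x) encode≡ ⟩
  lookup (encode 𝒞′) x ≡⟨ lookup∘tabulate _ x ⟩
  column (levels 𝒞′) x ∎)
  where open ≡-Reasoning

candidates : ∀ {m d} → Chain m (suc d) → List (Vec (Vec Bool (suc d)) m)
candidates 𝒜 = choices (λ x → columnChoices (column (levels 𝒜) x))

φN⊆candidates : ∀ {m R d} (𝒜 : Chain m (suc d)) → IsVertex m R (suc d) 𝒜 →
  ∀ {𝒞} → InφN m R d 𝒜 𝒞 → encode 𝒞 ∈ₗ candidates 𝒜
φN⊆candidates 𝒜@(α , As) (nested𝒜 , _) (ℬ@(β , Bs) , (nestedℬ , _) , adj , refl) =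
  ∈-choices _ _ λ x →
    subst (_∈ₗ columnChoices (column A x))
      (sym (trans (cong (λ Ss → column Ss x) (levels-φ ℬ)) (map-dropLast (λ S → lookup S x) B)))
      (dropLast∈columnChoices (column A x) (column B x)
        (column-crossLinked x A A (nested⇒monotone ⁅ α ⁆ As nested𝒜))
        (column-crossLinked x B B (nested⇒monotone ⁅ β ⁆ Bs nestedℬ))
        (column-crossLinked x A B (Adj⇒crossLinked 𝒜 ℬ adj))
        (column-crossLinked x B A (Adj⇒crossLinked ℬ 𝒜 (Adj-sym 𝒜 ℬ adj))))
  where
  A = levels 𝒜
  B = levels ℬ

length-candidates≤ : ∀ {m d} (𝒜 : Chain m (suc d)) → length (candidates 𝒜) ≤ 3 ^ sz 𝒜
length-candidates≤ 𝒜@(α , As) =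
  length-choices≤ 3 (top ⁅ α ⁆ As) _ (λ x → length-columnChoices≤3 (column (levels 𝒜) x))
    (λ x x∉top → length-columnChoices≤1 (column (levels 𝒜) x)
                   (trans (last-column ⁅ α ⁆ As x) (∉⇒lookup≡false x∉top)))

unique-φN⇒length≤3^sz : ∀ m R d (𝒜 : Chain m (suc d)) → IsVertex m R (suc d) 𝒜 →
  (L : List (Chain m d)) → Unique L → All (InφN m R d 𝒜) L → length L ≤ 3 ^ sz 𝒜
unique-φN⇒length≤3^sz m R d 𝒜 vertex L unique L⊆φN = begin
  length L                   ≡⟨ length-map encode L ⟨
  length (List.map encode L) ≤⟨ unique⊆⇒length≤ (Unique.map⁺ encode-injective unique) codes⊆candidates ⟩
  length (candidates 𝒜)      ≤⟨ length-candidates≤ 𝒜 ⟩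
  3 ^ sz 𝒜                   ∎
  where
  open ≤-Reasoning
  codes⊆candidates : List.map encode L ⊆ₗ candidates 𝒜
  codes⊆candidates c∈codes with ∈-map⁻ encode c∈codes
  ... | 𝒞 , 𝒞∈L , refl = φN⊆candidates 𝒜 vertex (All.lookup L⊆φN 𝒞∈L)

3^n≤2^[2n] : ∀ n → 3 ^ n ≤ 2 ^ (2 * n)
3^n≤2^[2n] n = ≤-trans (^-monoˡ-≤ n (n≤1+n 3)) (≤-reflexive (^-*-assoc 2 2 n))

lemma3p1 : (m R d : ℕ) → 0 < m → 0 < R →
    (𝒜 : Chain m (suc d)) → IsVertex m R (suc d) 𝒜 →
    ((L : List (Chain m d)) → Unique L → All (InφN m R d 𝒜) L →
      length L ≤ 2 ^ (2 * sz 𝒜))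
    × (2 ^ (2 * sz 𝒜) ≤ 2 ^ (2 * R))
lemma3p1 m R d _ _ 𝒜 vertex@(_ , sz≤R) = φN-bound , ^-monoʳ-≤ 2 (*-monoʳ-≤ 2 sz≤R)
  where
  φN-bound : (L : List (Chain m d)) → Unique L → All (InφN m R d 𝒜) L → length L ≤ 2 ^ (2 * sz 𝒜)
  φN-bound L unique L⊆φN =
    ≤-trans (unique-φN⇒length≤3^sz m R d 𝒜 vertex L unique L⊆φN) (3^n≤2^[2n] (sz 𝒜))
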